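{- Let $F:\mathcal{A}\to\mathcal{C}$ and $G:\mathcal{B}\to\mathcal{C}$ be functors, $\mathcal{G}=(F\downarrow G)$, $\mathcal{TG}$ the full subcategory of cosimple objects and $\mathscr{N}:\mathcal{TG}\to\mathcal{G}$ the inclusion. Assume $\mathcal{B}$ is coregular and $G$ is faithful, preserves epimorphisms, and has a left adjoint $G^{\diamond}$ whose unit $\delta:\mathrm{id}_{\mathcal{C}}\to GG^{\diamond}$ has epimorphic components. For $(A,f,B)$ in $\mathcal{G}$ let $\tilde f:G^{\diamond}F(A)\to B$ be the unique morphism with $G(\tilde f)\circ\delta_{F(A)}=f$, let $\tilde f=m_{\tilde f}\circ e_{\tilde f}$ be a coimage factorization ($e_{\tilde f}:G^{\diamond}F(A)\to\mathrm{coran}(\tilde f)$ epi, $m_{\tilde f}$ regular mono), and define $\mathcal{T}(A,f,B)=(A,G(e_{\tilde f})\circ\delta_{F(A)},\mathrm{coran}(\tilde f))$ and $\vartheta_{(A,f,B)}=(\mathrm{id}_A,m_{\tilde f}):\mathcal{T}(A,f,B)\to(A,f,B)$. Then for every cosimple $(A,f,B)$ and every morphism $(\phi,\psi):\mathscr{N}(A,f,B)\to(A',f',B')$ in $\mathcal{G}$ there is a unique morphism $(\tilde\phi,\tilde\psi):(A,f,B)\to\mathcal{T}(A',f',B')$ in $\mathcal{TG}$ with $\vartheta_{(A',f',B')}\circ\mathscr{N}(\tilde\phi,\tilde\psi)=(\phi,\psi)$. Consequently $\mathcal{TG}$ is a coreflective subcategory of $\mathcal{G}$.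
   Context: The comma category $(F\downarrow G)$ has objects $(A,f,B)$ with $f:F(A)\to G(B)$ in $\mathcal{C}$, and morphisms $(\phi,\psi):(A,f,B)\to(A',f',B')$ with $f'\circ F(\phi)=G(\psi)\circ f$. An object $(A,f,B)$ is cosimple if $f$ is an epimorphism in $\mathcal{C}$. A coregular category has (epi, regular mono) coimage factorizations. -}

module Defs where

open import Level using (Level; _⊔_) renaming (suc to lsuc)
open import Relation.Binary using (Rel; IsEquivalence; Setoid)
open import Data.Product using (Σ; Σ-syntax; _×_; _,_; proj₁; proj₂)
import Relation.Binary.Reasoning.Setoid as SetoidR

record Category (o ℓ e : Level) : Set (lsuc (o ⊔ ℓ ⊔ e)) where
  infix  4 _≈_
  infixr 9 _∘_
  field
    Obj       : Set o
    _⇒_       : Obj → Obj → Set ℓ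
    _≈_       : ∀ {A B} → Rel (A ⇒ B) e
    id        : ∀ {A} → A ⇒ A
    _∘_       : ∀ {A B C} → B ⇒ C → A ⇒ B → A ⇒ C
    equiv     : ∀ {A B} → IsEquivalence (_≈_ {A} {B})
    assoc     : ∀ {A B C D} {f : A ⇒ B} {g : B ⇒ C} {h : C ⇒ D} →
                (h ∘ g) ∘ f ≈ h ∘ (g ∘ f)
    identityˡ : ∀ {A B} {f : A ⇒ B} → id ∘ f ≈ f
    identityʳ : ∀ {A B} {f : A ⇒ B} → f ∘ id ≈ f
    ∘-resp-≈  : ∀ {A B C} {f h : B ⇒ C} {g i : A ⇒ B} →
                f ≈ h → g ≈ i → f ∘ g ≈ h ∘ i

  hom-setoid : Obj → Obj → Setoid ℓ e
  hom-setoid A B = record { Carrier = A ⇒ B ; _≈_ = _≈_ ; isEquivalence = equiv }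

  module Eq {A B : Obj} = IsEquivalence (equiv {A} {B})

  Epi : ∀ {A B} → A ⇒ B → Set (o ⊔ ℓ ⊔ e)
  Epi {A} {B} f = ∀ {C} (g h : B ⇒ C) → g ∘ f ≈ h ∘ f → g ≈ h

  Mono : ∀ {A B} → A ⇒ B → Set (o ⊔ ℓ ⊔ e)
  Mono {A} {B} f = ∀ {C} (g h : C ⇒ A) → f ∘ g ≈ f ∘ h → g ≈ h

  ∃![_,_] : ∀ {p} (A B : Obj) → (A ⇒ B → Set p) → Set (ℓ ⊔ e ⊔ p)
  ∃![ A , B ] P = Σ[ u ∈ A ⇒ B ] (P u × (∀ v → P v → u ≈ v))

  IsEqualizer : ∀ {E A C} → E ⇒ A → A ⇒ C → A ⇒ C → Set (o ⊔ ℓ ⊔ e)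
  IsEqualizer {E} {A} {C} m g h =
    (g ∘ m ≈ h ∘ m) ×
    (∀ {X} (x : X ⇒ A) → g ∘ x ≈ h ∘ x → ∃![ X , E ] (λ u → m ∘ u ≈ x))

  RegularMono : ∀ {E A} → E ⇒ A → Set (o ⊔ ℓ ⊔ e)
  RegularMono {E} {A} m = Σ[ C ∈ Obj ] Σ[ g ∈ A ⇒ C ] Σ[ h ∈ A ⇒ C ] IsEqualizer m g h


-- Coregular categories: (epi, regular mono) coimage factorizations
-- (a chosen factorization f ≈ m_f ∘ e_f for every morphism f)

record Coregular {o ℓ e} (𝒞 : Category o ℓ e) : Set (o ⊔ ℓ ⊔ e) where
  open Category 𝒞
  field
    coran    : ∀ {A B} → A ⇒ B → Obj
    coimg-e  : ∀ {A B} (f : A ⇒ B) → A ⇒ coran f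
    coimg-m  : ∀ {A B} (f : A ⇒ B) → coran f ⇒ B
    e-epi    : ∀ {A B} (f : A ⇒ B) → Epi (coimg-e f)
    m-regmono : ∀ {A B} (f : A ⇒ B) → RegularMono (coimg-m f)
    factor   : ∀ {A B} (f : A ⇒ B) → f ≈ coimg-m f ∘ coimg-e f

record Functor {o ℓ e o′ ℓ′ e′} (C : Category o ℓ e) (D : Category o′ ℓ′ e′)
       : Set (o ⊔ ℓ ⊔ e ⊔ o′ ⊔ ℓ′ ⊔ e′) where
  private
    module C = Category C
    module D = Category D
  field
    F₀           : C.Obj → D.Obj
    F₁           : ∀ {A B} → A C.⇒ B → F₀ A D.⇒ F₀ B
    identity     : ∀ {A} → F₁ (C.id {A}) D.≈ D.id
    homomorphism : ∀ {X Y Z} {f : X C.⇒ Y} {g : Y C.⇒ Z} →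
                   F₁ (g C.∘ f) D.≈ F₁ g D.∘ F₁ f
    F-resp-≈     : ∀ {A B} {f g : A C.⇒ B} → f C.≈ g → F₁ f D.≈ F₁ g

Faithful : ∀ {o ℓ e o′ ℓ′ e′} {C : Category o ℓ e} {D : Category o′ ℓ′ e′} →
           Functor C D → Set (o ⊔ ℓ ⊔ e ⊔ e′)
Faithful {C = C} {D} F =
  ∀ {A B} (f g : A C.⇒ B) → F₁ f D.≈ F₁ g → f C.≈ g
  where module C = Category C
        module D = Category D
        open Functor F

PreservesEpi : ∀ {o ℓ e o′ ℓ′ e′} {C : Category o ℓ e} {D : Category o′ ℓ′ e′} →
               Functor C D → Set (o ⊔ ℓ ⊔ e ⊔ o′ ⊔ ℓ′ ⊔ e′)
PreservesEpi {C = C} {D} F =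
  ∀ {A B} (f : A C.⇒ B) → C.Epi f → D.Epi (F₁ f)
  where module C = Category C
        module D = Category D
        open Functor F

record Adjunction {o ℓ e o′ ℓ′ e′} {C : Category o ℓ e} {D : Category o′ ℓ′ e′}
       (L : Functor C D) (R : Functor D C) : Set (o ⊔ ℓ ⊔ e ⊔ o′ ⊔ ℓ′ ⊔ e′) where
  private
    module C = Category C
    module D = Category D
    module L = Functor L
    module R = Functor R
  field
    unit          : ∀ X → X C.⇒ R.F₀ (L.F₀ X)
    counit        : ∀ Y → L.F₀ (R.F₀ Y) D.⇒ Y
    unit-natural  : ∀ {X X′} (f : X C.⇒ X′) →
                    unit X′ C.∘ f C.≈ R.F₁ (L.F₁ f) C.∘ unit X
    counit-natural : ∀ {Y Y′} (g : Y D.⇒ Y′) →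
                    counit Y′ D.∘ L.F₁ (R.F₁ g) D.≈ g D.∘ counit Y
    zig           : ∀ X → counit (L.F₀ X) D.∘ L.F₁ (unit X) D.≈ D.id
    zag           : ∀ Y → R.F₁ (counit Y) C.∘ unit (R.F₀ Y) C.≈ C.id

FullSub : ∀ {o ℓ e p} (C : Category o ℓ e) → (Category.Obj C → Set p) → Category (o ⊔ p) ℓ e
FullSub C P = record
  { Obj = Σ Obj P
  ; _⇒_ = λ X Y → proj₁ X ⇒ proj₁ Y
  ; _≈_ = _≈_
  ; id = id
  ; _∘_ = _∘_
  ; equiv = equiv
  ; assoc = assoc
  ; identityˡ = identityˡ
  ; identityʳ = identityʳ
  ; ∘-resp-≈ = ∘-resp-≈
  }
  where open Category C

Inclusion : ∀ {o ℓ e p} (C : Category o ℓ e) (P : Category.Obj C → Set p) → Functor (FullSub C P) C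
Inclusion C P = record
  { F₀ = proj₁
  ; F₁ = λ f → f
  ; identity = Eq.refl
  ; homomorphism = Eq.refl
  ; F-resp-≈ = λ p → p
  }
  where open Category C

module _ {oa ℓa ea ob ℓb eb oc ℓc ec}
         {𝒜 : Category oa ℓa ea} {ℬ : Category ob ℓb eb} {𝒞 : Category oc ℓc ec}
         (F : Functor 𝒜 𝒞) (G : Functor ℬ 𝒞) where
  private
    module A = Category 𝒜
    module B = Category ℬ
    module C = Category 𝒞
    module F = Functor F
    module G = Functor G

  record CommaObj : Set (oa ⊔ ob ⊔ ℓc) where
    constructor triple
    field
      dom : A.Obj
      cod : B.Obj
      arr : F.F₀ dom C.⇒ G.F₀ cod
  open CommaObj public

  record CommaHom (X Y : CommaObj) : Set (ℓa ⊔ ℓb ⊔ ec) where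
    constructor commaHom
    field
      φ       : dom X A.⇒ dom Y
      ψ       : cod X B.⇒ cod Y
      commute : arr Y C.∘ F.F₁ φ C.≈ G.F₁ ψ C.∘ arr X
  open CommaHom public

  private
    id-commute : ∀ (X : CommaObj) → arr X C.∘ F.F₁ A.id C.≈ G.F₁ B.id C.∘ arr X
    id-commute X = begin
        arr X C.∘ F.F₁ A.id   ≈⟨ C.∘-resp-≈ C.Eq.refl F.identity ⟩
        arr X C.∘ C.id        ≈⟨ C.identityʳ ⟩
        arr X                 ≈⟨ C.Eq.sym C.identityˡ ⟩
        C.id C.∘ arr X        ≈⟨ C.∘-resp-≈ (C.Eq.sym G.identity) C.Eq.refl ⟩
        G.F₁ B.id C.∘ arr X   ∎
      where open SetoidR (C.hom-setoid _ _)

    ∘-commute : ∀ {X Y Z} (g : CommaHom Y Z) (f : CommaHom X Y) →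
                arr Z C.∘ F.F₁ (φ g A.∘ φ f) C.≈ G.F₁ (ψ g B.∘ ψ f) C.∘ arr X
    ∘-commute {X} {Y} {Z} g f = begin
        arr Z C.∘ F.F₁ (φ g A.∘ φ f)           ≈⟨ C.∘-resp-≈ C.Eq.refl F.homomorphism ⟩
        arr Z C.∘ (F.F₁ (φ g) C.∘ F.F₁ (φ f))  ≈⟨ C.Eq.sym C.assoc ⟩
        (arr Z C.∘ F.F₁ (φ g)) C.∘ F.F₁ (φ f)  ≈⟨ C.∘-resp-≈ (commute g) C.Eq.refl ⟩
        (G.F₁ (ψ g) C.∘ arr Y) C.∘ F.F₁ (φ f)  ≈⟨ C.assoc ⟩
        G.F₁ (ψ g) C.∘ (arr Y C.∘ F.F₁ (φ f))  ≈⟨ C.∘-resp-≈ C.Eq.refl (commute f) ⟩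
        G.F₁ (ψ g) C.∘ (G.F₁ (ψ f) C.∘ arr X)  ≈⟨ C.Eq.sym C.assoc ⟩
        (G.F₁ (ψ g) C.∘ G.F₁ (ψ f)) C.∘ arr X  ≈⟨ C.∘-resp-≈ (C.Eq.sym G.homomorphism) C.Eq.refl ⟩
        G.F₁ (ψ g B.∘ ψ f) C.∘ arr X           ∎
      where open SetoidR (C.hom-setoid _ _)

  Comma : Category (oa ⊔ ob ⊔ ℓc) (ℓa ⊔ ℓb ⊔ ec) (ea ⊔ eb)
  Comma = record
    { Obj = CommaObj
    ; _⇒_ = CommaHom
    ; _≈_ = λ f g → (φ f A.≈ φ g) × (ψ f B.≈ ψ g)
    ; id = λ {X} → commaHom A.id B.id (id-commute X)
    ; _∘_ = λ g f → commaHom (φ g A.∘ φ f) (ψ g B.∘ ψ f) (∘-commute g f)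
    ; equiv = record
        { refl = A.Eq.refl , B.Eq.refl
        ; sym = λ (p , q) → A.Eq.sym p , B.Eq.sym q
        ; trans = λ (p , q) (p′ , q′) → A.Eq.trans p p′ , B.Eq.trans q q′
        }
    ; assoc = A.assoc , B.assoc
    ; identityˡ = A.identityˡ , B.identityˡ
    ; identityʳ = A.identityʳ , B.identityʳ
    ; ∘-resp-≈ = λ (p , q) (p′ , q′) → A.∘-resp-≈ p p′ , B.∘-resp-≈ q q′
    }

  Cosimple : CommaObj → Set (oc ⊔ ℓc ⊔ ec)
  Cosimple X = C.Epi (arr X)

  TG : Category (oa ⊔ ob ⊔ oc ⊔ ℓc ⊔ ec) (ℓa ⊔ ℓb ⊔ ec) (ea ⊔ eb)
  TG = FullSub Comma Cosimple

  𝒩 : Functor TG Comma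
  𝒩 = Inclusion Comma Cosimple

Coreflective : ∀ {o ℓ e p} (C : Category o ℓ e) (P : Category.Obj C → Set p) →
               Set (o ⊔ ℓ ⊔ e ⊔ p)
Coreflective C P = Σ[ R ∈ Functor C (FullSub C P) ] Adjunction (Inclusion C P) R

module Construction {oa ℓa ea ob ℓb eb oc ℓc ec}
         {𝒜 : Category oa ℓa ea} {ℬ : Category ob ℓb eb} {𝒞 : Category oc ℓc ec}
         (F : Functor 𝒜 𝒞) (G : Functor ℬ 𝒞) (coreg : Coregular ℬ)
         (L : Functor 𝒞 ℬ) (adj : Adjunction L G) where
  private
    module A = Category 𝒜
    module B = Category ℬ
    module C = Category 𝒞
    module F = Functor F
    module G = Functor G
    module L = Functor L
    open Adjunction adj
    open Coregular coreg

  δ : ∀ X → X C.⇒ G.F₀ (L.F₀ X)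
  δ = unit

  tilde : ∀ {X Y} → X C.⇒ G.F₀ Y → L.F₀ X B.⇒ Y
  tilde {X} {Y} f = counit Y B.∘ L.F₁ f

  tilde-prop : ∀ {X Y} (f : X C.⇒ G.F₀ Y) → G.F₁ (tilde f) C.∘ δ X C.≈ f
  tilde-prop {X} {Y} f = begin
      G.F₁ (counit Y B.∘ L.F₁ f) C.∘ unit X                 ≈⟨ C.∘-resp-≈ G.homomorphism C.Eq.refl ⟩
      (G.F₁ (counit Y) C.∘ G.F₁ (L.F₁ f)) C.∘ unit X        ≈⟨ C.assoc ⟩
      G.F₁ (counit Y) C.∘ (G.F₁ (L.F₁ f) C.∘ unit X)        ≈⟨ C.∘-resp-≈ C.Eq.refl (C.Eq.sym (unit-natural f)) ⟩
      G.F₁ (counit Y) C.∘ (unit (G.F₀ Y) C.∘ f)             ≈⟨ C.Eq.sym C.assoc ⟩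
      (G.F₁ (counit Y) C.∘ unit (G.F₀ Y)) C.∘ f             ≈⟨ C.∘-resp-≈ (zag Y) C.Eq.refl ⟩
      C.id C.∘ f                                            ≈⟨ C.identityˡ ⟩
      f                                                     ∎
    where open SetoidR (C.hom-setoid _ _)

  T : CommaObj F G → CommaObj F G
  T X = triple (dom X) (coran (tilde (arr X)))
               (G.F₁ (coimg-e (tilde (arr X))) C.∘ δ (F.F₀ (dom X)))

  ϑ : ∀ X → CommaHom F G (T X) X
  ϑ X = commaHom A.id (coimg-m f̃) proof
    where
      f̃ = tilde (arr X)
      m = coimg-m f̃
      e = coimg-e f̃
      δA = δ (F.F₀ (dom X))
      open SetoidR (C.hom-setoid _ _)
      proof : arr X C.∘ F.F₁ A.id C.≈ G.F₁ m C.∘ (G.F₁ e C.∘ δA)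
      proof = begin
        arr X C.∘ F.F₁ A.id               ≈⟨ C.∘-resp-≈ C.Eq.refl F.identity ⟩
        arr X C.∘ C.id                    ≈⟨ C.identityʳ ⟩
        arr X                             ≈⟨ C.Eq.sym (tilde-prop (arr X)) ⟩
        G.F₁ f̃ C.∘ δA                     ≈⟨ C.∘-resp-≈ (G.F-resp-≈ (factor f̃)) C.Eq.refl ⟩
        G.F₁ (m B.∘ e) C.∘ δA             ≈⟨ C.∘-resp-≈ G.homomorphism C.Eq.refl ⟩
        (G.F₁ m C.∘ G.F₁ e) C.∘ δA        ≈⟨ C.assoc ⟩
        G.F₁ m C.∘ (G.F₁ e C.∘ δA)        ∎

  T-cosimple : PreservesEpi G → (∀ X → C.Epi (δ X)) → ∀ X → Cosimple F G (T X)
  T-cosimple G-epi δ-epi X g h p =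
    G-epi e (e-epi f̃) g h
      (δ-epi _ (g C.∘ G.F₁ e) (h C.∘ G.F₁ e)
        (C.Eq.trans C.assoc (C.Eq.trans p (C.Eq.sym C.assoc))))
    where
      f̃ = tilde (arr X)
      e = coimg-e f̃

  T̂ : PreservesEpi G → (∀ X → C.Epi (δ X)) → CommaObj F G → Category.Obj (TG F G)
  T̂ G-epi δ-epi X = T X , T-cosimple G-epi δ-epi X

-- Given (φ , ψ) out of a cosimple (A₀ , f₀ , B₀), ψ factors through
-- the equalizer m: G(ψ) ∘ f₀ = f ∘ F(φ) factors through G(m), so the pair that m
-- equalizes agrees on G(ψ) ∘ f₀, hence on ψ because f₀ is epi and G is faithful.
-- The lifted square commutes because G, a right adjoint, keeps m monic; the
-- coreflection is then assembled from these couniversal arrows.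
module Submission where

open import Defs
open import Level using (Level)
open import Data.Product using (_×_; _,_; proj₁; proj₂)
import Relation.Binary.Reasoning.Setoid as SetoidR

module _ {o ℓ e} {𝒞 : Category o ℓ e} where
  open Category 𝒞

  RegularMono⇒Mono : ∀ {E A} {m : E ⇒ A} → RegularMono m → Mono m
  RegularMono⇒Mono {m = m} (_ , g , h , g∘m≈h∘m , universal) a b m∘a≈m∘b =
    Eq.trans (Eq.sym (unique a Eq.refl)) (unique b (Eq.sym m∘a≈m∘b))
    where
      m∘a-equalizes : g ∘ (m ∘ a) ≈ h ∘ (m ∘ a)
      m∘a-equalizes = Eq.trans (Eq.sym assoc) (Eq.trans (∘-resp-≈ g∘m≈h∘m Eq.refl) assoc)
      unique = proj₂ (proj₂ (universal (m ∘ a) m∘a-equalizes))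

module AdjunctionProperties {o ℓ e o′ ℓ′ e′} {𝒞 : Category o ℓ e} {𝒟 : Category o′ ℓ′ e′}
                            {L : Functor 𝒞 𝒟} {R : Functor 𝒟 𝒞} (adj : Adjunction L R) where
  private
    module C = Category 𝒞
    module D = Category 𝒟
    module L = Functor L
    module R = Functor R
  open Adjunction adj

  transpose : ∀ {X Y} → X C.⇒ R.F₀ Y → L.F₀ X D.⇒ Y
  transpose {Y = Y} f = counit Y D.∘ L.F₁ f

  R-transpose∘unit : ∀ {X Y} (f : X C.⇒ R.F₀ Y) → R.F₁ (transpose f) C.∘ unit X C.≈ f
  R-transpose∘unit {X} {Y} f = begin
    R.F₁ (counit Y D.∘ L.F₁ f) C.∘ unit X           ≈⟨ C.∘-resp-≈ R.homomorphism C.Eq.refl ⟩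
    (R.F₁ (counit Y) C.∘ R.F₁ (L.F₁ f)) C.∘ unit X  ≈⟨ C.assoc ⟩
    R.F₁ (counit Y) C.∘ (R.F₁ (L.F₁ f) C.∘ unit X)  ≈⟨ C.∘-resp-≈ C.Eq.refl (C.Eq.sym (unit-natural f)) ⟩
    R.F₁ (counit Y) C.∘ (unit (R.F₀ Y) C.∘ f)       ≈⟨ C.Eq.sym C.assoc ⟩
    (R.F₁ (counit Y) C.∘ unit (R.F₀ Y)) C.∘ f       ≈⟨ C.∘-resp-≈ (zag Y) C.Eq.refl ⟩
    C.id C.∘ f                                      ≈⟨ C.identityˡ ⟩
    f                                               ∎
    where open SetoidR (C.hom-setoid _ _)

  transpose-injective : ∀ {X Y} {f f′ : X C.⇒ R.F₀ Y} → transpose f D.≈ transpose f′ → f C.≈ f′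
  transpose-injective {X} {f = f} {f′} tf≈tf′ = begin
    f                                ≈⟨ C.Eq.sym (R-transpose∘unit f) ⟩
    R.F₁ (transpose f) C.∘ unit X    ≈⟨ C.∘-resp-≈ (R.F-resp-≈ tf≈tf′) C.Eq.refl ⟩
    R.F₁ (transpose f′) C.∘ unit X   ≈⟨ R-transpose∘unit f′ ⟩
    f′                               ∎
    where open SetoidR (C.hom-setoid _ _)

  transpose-natural : ∀ {X Y Y′} (g : Y D.⇒ Y′) (f : X C.⇒ R.F₀ Y) →
                      g D.∘ transpose f D.≈ transpose (R.F₁ g C.∘ f)
  transpose-natural {Y = Y} {Y′} g f = begin
    g D.∘ (counit Y D.∘ L.F₁ f)                ≈⟨ D.Eq.sym D.assoc ⟩
    (g D.∘ counit Y) D.∘ L.F₁ f                ≈⟨ D.∘-resp-≈ (D.Eq.sym (counit-natural g)) D.Eq.refl ⟩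
    (counit Y′ D.∘ L.F₁ (R.F₁ g)) D.∘ L.F₁ f   ≈⟨ D.assoc ⟩
    counit Y′ D.∘ (L.F₁ (R.F₁ g) D.∘ L.F₁ f)   ≈⟨ D.∘-resp-≈ D.Eq.refl (D.Eq.sym L.homomorphism) ⟩
    counit Y′ D.∘ L.F₁ (R.F₁ g C.∘ f)          ∎
    where open SetoidR (D.hom-setoid _ _)

  R-preserves-Mono : ∀ {E B} {m : E D.⇒ B} → D.Mono m → C.Mono (R.F₁ m)
  R-preserves-Mono {m = m} m-mono a b Rm∘a≈Rm∘b = transpose-injective (m-mono _ _ (begin
    m D.∘ transpose a          ≈⟨ transpose-natural m a ⟩
    transpose (R.F₁ m C.∘ a)   ≈⟨ D.∘-resp-≈ D.Eq.refl (L.F-resp-≈ Rm∘a≈Rm∘b) ⟩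
    transpose (R.F₁ m C.∘ b)   ≈⟨ D.Eq.sym (transpose-natural m b) ⟩
    m D.∘ transpose b          ∎))
    where open SetoidR (D.hom-setoid _ _)

module _ {o ℓ e o′ ℓ′ e′} {ℬ : Category o ℓ e} {𝒞 : Category o′ ℓ′ e′}
         (G : Functor ℬ 𝒞) (G-faithful : Faithful G) where
  private
    module B = Category ℬ
    module C = Category 𝒞
    open Functor G

  faithful-epi-equalizes : ∀ {E B B′ Q X} {m : E B.⇒ B′} {g k : B′ B.⇒ Q} {ψ : B B.⇒ B′}
                             {f : X C.⇒ F₀ B} {w : X C.⇒ F₀ E} →
                           g B.∘ m B.≈ k B.∘ m → C.Epi f → F₁ ψ C.∘ f C.≈ F₁ m C.∘ w →
                           g B.∘ ψ B.≈ k B.∘ ψ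
  faithful-epi-equalizes {m = m} {g} {k} {ψ} {f} {w} g∘m≈k∘m f-epi Gψ∘f≈Gm∘w =
    G-faithful _ _ (f-epi _ _ (C.Eq.trans (through g)
      (C.Eq.trans (C.∘-resp-≈ (F-resp-≈ g∘m≈k∘m) C.Eq.refl) (C.Eq.sym (through k)))))
    where
      through : ∀ {Q} (x : _ B.⇒ Q) → F₁ (x B.∘ ψ) C.∘ f C.≈ F₁ (x B.∘ m) C.∘ w
      through x = begin
        F₁ (x B.∘ ψ) C.∘ f        ≈⟨ C.∘-resp-≈ homomorphism C.Eq.refl ⟩
        (F₁ x C.∘ F₁ ψ) C.∘ f     ≈⟨ C.assoc ⟩
        F₁ x C.∘ (F₁ ψ C.∘ f)     ≈⟨ C.∘-resp-≈ C.Eq.refl Gψ∘f≈Gm∘w ⟩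
        F₁ x C.∘ (F₁ m C.∘ w)     ≈⟨ C.Eq.sym C.assoc ⟩
        (F₁ x C.∘ F₁ m) C.∘ w     ≈⟨ C.∘-resp-≈ (C.Eq.sym homomorphism) C.Eq.refl ⟩
        F₁ (x B.∘ m) C.∘ w        ∎
        where open SetoidR (C.hom-setoid _ _)

module CoreflectionFromCouniversal {o ℓ e p} (𝒟 : Category o ℓ e) (P : Category.Obj 𝒟 → Set p)
  (R₀ : Category.Obj 𝒟 → Category.Obj (FullSub 𝒟 P))
  (ε : ∀ Y → Category._⇒_ 𝒟 (proj₁ (R₀ Y)) Y)
  (couniversal : ∀ X Y (h : Category._⇒_ 𝒟 (proj₁ X) Y) →
                 Category.∃![_,_] (FullSub 𝒟 P) X (R₀ Y) (λ u → Category._≈_ 𝒟 (Category._∘_ 𝒟 (ε Y) u) h))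
  where
  open Category 𝒟

  lift : ∀ X {Y} → proj₁ X ⇒ Y → proj₁ X ⇒ proj₁ (R₀ Y)
  lift X h = proj₁ (couniversal X _ h)

  ε∘lift : ∀ X {Y} (h : proj₁ X ⇒ Y) → ε Y ∘ lift X h ≈ h
  ε∘lift X h = proj₁ (proj₂ (couniversal X _ h))

  lift-unique : ∀ X {Y} {v w : proj₁ X ⇒ proj₁ (R₀ Y)} → ε Y ∘ v ≈ ε Y ∘ w → v ≈ w
  lift-unique X {Y} {v} {w} ε∘v≈ε∘w =
    Eq.trans (Eq.sym (unique v Eq.refl)) (unique w (Eq.sym ε∘v≈ε∘w))
    where unique = proj₂ (proj₂ (couniversal X Y (ε Y ∘ v)))

  R₁ : ∀ {Y Y′} → Y ⇒ Y′ → proj₁ (R₀ Y) ⇒ proj₁ (R₀ Y′)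
  R₁ {Y} g = lift (R₀ Y) (g ∘ ε Y)

  ε-natural : ∀ {Y Y′} (g : Y ⇒ Y′) → ε Y′ ∘ R₁ g ≈ g ∘ ε Y
  ε-natural {Y} g = ε∘lift (R₀ Y) (g ∘ ε Y)

  R₁-∘ : ∀ {X Y Z} (f : X ⇒ Y) (g : Y ⇒ Z) → R₁ (g ∘ f) ≈ R₁ g ∘ R₁ f
  R₁-∘ {X} {Y} {Z} f g = lift-unique (R₀ X) (begin
    ε Z ∘ R₁ (g ∘ f)      ≈⟨ ε-natural (g ∘ f) ⟩
    (g ∘ f) ∘ ε X         ≈⟨ assoc ⟩
    g ∘ (f ∘ ε X)         ≈⟨ ∘-resp-≈ Eq.refl (Eq.sym (ε-natural f)) ⟩
    g ∘ (ε Y ∘ R₁ f)      ≈⟨ Eq.sym assoc ⟩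
    (g ∘ ε Y) ∘ R₁ f      ≈⟨ ∘-resp-≈ (Eq.sym (ε-natural g)) Eq.refl ⟩
    (ε Z ∘ R₁ g) ∘ R₁ f   ≈⟨ assoc ⟩
    ε Z ∘ (R₁ g ∘ R₁ f)   ∎)
    where open SetoidR (hom-setoid _ _)

  R : Functor 𝒟 (FullSub 𝒟 P)
  R = record
    { F₀ = R₀
    ; F₁ = R₁
    ; identity = λ {Y} → lift-unique (R₀ Y)
        (Eq.trans (ε-natural id) (Eq.trans identityˡ (Eq.sym identityʳ)))
    ; homomorphism = λ {_} {_} {_} {f} {g} → R₁-∘ f g
    ; F-resp-≈ = λ {X} {_} {f} {g} f≈g → lift-unique (R₀ X)
        (Eq.trans (ε-natural f) (Eq.trans (∘-resp-≈ f≈g Eq.refl) (Eq.sym (ε-natural g))))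
    }

  η : ∀ X → proj₁ X ⇒ proj₁ (R₀ (proj₁ X))
  η X = lift X id

  η-natural : ∀ {X X′} (f : proj₁ X ⇒ proj₁ X′) → η X′ ∘ f ≈ R₁ f ∘ η X
  η-natural {X} {X′} f = lift-unique X (begin
    ε _ ∘ (η X′ ∘ f)       ≈⟨ Eq.sym assoc ⟩
    (ε _ ∘ η X′) ∘ f       ≈⟨ ∘-resp-≈ (ε∘lift X′ id) Eq.refl ⟩
    id ∘ f                 ≈⟨ identityˡ ⟩
    f                      ≈⟨ Eq.sym identityʳ ⟩
    f ∘ id                 ≈⟨ ∘-resp-≈ Eq.refl (Eq.sym (ε∘lift X id)) ⟩
    f ∘ (ε _ ∘ η X)        ≈⟨ Eq.sym assoc ⟩
    (f ∘ ε _) ∘ η X        ≈⟨ ∘-resp-≈ (Eq.sym (ε-natural f)) Eq.refl ⟩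
    (ε _ ∘ R₁ f) ∘ η X     ≈⟨ assoc ⟩
    ε _ ∘ (R₁ f ∘ η X)     ∎)
    where open SetoidR (hom-setoid _ _)

  R₁ε∘η≈id : ∀ Y → R₁ (ε Y) ∘ η (R₀ Y) ≈ id
  R₁ε∘η≈id Y = lift-unique (R₀ Y) (begin
    ε Y ∘ (R₁ (ε Y) ∘ η (R₀ Y))   ≈⟨ Eq.sym assoc ⟩
    (ε Y ∘ R₁ (ε Y)) ∘ η (R₀ Y)   ≈⟨ ∘-resp-≈ (ε-natural (ε Y)) Eq.refl ⟩
    (ε Y ∘ ε _) ∘ η (R₀ Y)        ≈⟨ assoc ⟩
    ε Y ∘ (ε _ ∘ η (R₀ Y))        ≈⟨ ∘-resp-≈ Eq.refl (ε∘lift (R₀ Y) id) ⟩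
    ε Y ∘ id                      ∎)
    where open SetoidR (hom-setoid _ _)

  R-adjunction : Adjunction (Inclusion 𝒟 P) R
  R-adjunction = record
    { unit = η
    ; counit = ε
    ; unit-natural = η-natural
    ; counit-natural = ε-natural
    ; zig = λ X → ε∘lift X id
    ; zag = R₁ε∘η≈id
    }

  coreflective : Coreflective 𝒟 P
  coreflective = R , R-adjunction

module CosimpleCoreflection {oa ℓa ea ob ℓb eb oc ℓc ec : Level}
    {𝒜 : Category oa ℓa ea} {ℬ : Category ob ℓb eb} {𝒞 : Category oc ℓc ec}
    (F : Functor 𝒜 𝒞) (G : Functor ℬ 𝒞) (coreg : Coregular ℬ)
    (G-faithful : Faithful G) (G-epi : PreservesEpi G)
    (G◇ : Functor 𝒞 ℬ) (adj : Adjunction G◇ G)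
    (δ-epi : ∀ X → Category.Epi 𝒞 (Construction.δ F G coreg G◇ adj X)) where
  private
    module A = Category 𝒜
    module B = Category ℬ
    module C = Category 𝒞
    module F = Functor F
    module G = Functor G
    module 𝒢 = Category (Comma F G)
    module 𝒯𝒢 = Category (TG F G)
  open Coregular coreg
  open Construction F G coreg G◇ adj
  open AdjunctionProperties adj using (R-preserves-Mono)

  arr≈Gm∘arrT : ∀ Y → arr Y C.≈ G.F₁ (coimg-m (tilde (arr Y))) C.∘ arr (T Y)
  arr≈Gm∘arrT Y = C.Eq.trans (C.Eq.sym (C.Eq.trans (C.∘-resp-≈ C.Eq.refl F.identity) C.identityʳ))
                             (commute (ϑ Y))

  ϑ-couniversal : ∀ (X : 𝒯𝒢.Obj) (Y : CommaObj F G) (h : proj₁ X 𝒢.⇒ Y) →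
                  𝒯𝒢.∃![ X , T̂ G-epi δ-epi Y ] (λ u → ϑ Y 𝒢.∘ u 𝒢.≈ h)
  ϑ-couniversal (X , arrX-epi) Y (commaHom φ′ ψ′ square) =
    commaHom φ′ ψ̃ squarẽ , (A.identityˡ , m∘ψ̃≈ψ′) ,
    λ v (id∘φv≈φ′ , m∘ψv≈ψ′) → A.Eq.trans (A.Eq.sym id∘φv≈φ′) A.identityˡ , unique (ψ v) m∘ψv≈ψ′
    where
      m = coimg-m (tilde (arr Y))
      w = arr (T Y) C.∘ F.F₁ φ′
      Gψ′∘arrX≈Gm∘w : G.F₁ ψ′ C.∘ arr X C.≈ G.F₁ m C.∘ w
      Gψ′∘arrX≈Gm∘w = C.Eq.trans (C.Eq.sym square)
                        (C.Eq.trans (C.∘-resp-≈ (arr≈Gm∘arrT Y) C.Eq.refl) C.assoc)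
      m-regular = m-regmono (tilde (arr Y))
      m-equalizes = proj₁ (proj₂ (proj₂ (proj₂ m-regular)))
      ψ′-lifts = proj₂ (proj₂ (proj₂ (proj₂ m-regular))) ψ′
                   (faithful-epi-equalizes G G-faithful m-equalizes arrX-epi Gψ′∘arrX≈Gm∘w)
      ψ̃ = proj₁ ψ′-lifts
      m∘ψ̃≈ψ′ = proj₁ (proj₂ ψ′-lifts)
      unique = proj₂ (proj₂ ψ′-lifts)
      squarẽ : w C.≈ G.F₁ ψ̃ C.∘ arr X
      squarẽ = R-preserves-Mono (RegularMono⇒Mono {𝒞 = ℬ} m-regular) _ _ (begin
        G.F₁ m C.∘ w                   ≈⟨ C.Eq.sym Gψ′∘arrX≈Gm∘w ⟩
        G.F₁ ψ′ C.∘ arr X              ≈⟨ C.∘-resp-≈ (G.F-resp-≈ (B.Eq.sym m∘ψ̃≈ψ′)) C.Eq.refl ⟩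
        G.F₁ (m B.∘ ψ̃) C.∘ arr X       ≈⟨ C.∘-resp-≈ G.homomorphism C.Eq.refl ⟩
        (G.F₁ m C.∘ G.F₁ ψ̃) C.∘ arr X  ≈⟨ C.assoc ⟩
        G.F₁ m C.∘ (G.F₁ ψ̃ C.∘ arr X)  ∎)
        where open SetoidR (C.hom-setoid _ _)

  coreflective : Coreflective (Comma F G) (Cosimple F G)
  coreflective = CoreflectionFromCouniversal.coreflective (Comma F G) (Cosimple F G)
                   (T̂ G-epi δ-epi) ϑ ϑ-couniversal

mainTheorem13 : ∀ {oa ℓa ea ob ℓb eb oc ℓc ec : Level}
                  {𝒜 : Category oa ℓa ea} {ℬ : Category ob ℓb eb} {𝒞 : Category oc ℓc ec}
                  (F : Functor 𝒜 𝒞) (G : Functor ℬ 𝒞)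
                  (coreg : Coregular ℬ)
                  (G-faithful : Faithful G)
                  (G-epi : PreservesEpi G)
                  (G◇ : Functor 𝒞 ℬ) (adj : Adjunction G◇ G)
                  (δ-epi : ∀ X → Category.Epi 𝒞 (Construction.δ F G coreg G◇ adj X)) →
                  (∀ (X : Category.Obj (TG F G)) (Y : CommaObj F G)
                     (h : Category._⇒_ (Comma F G) (Functor.F₀ (𝒩 F G) X) Y) →
                     Category.∃![_,_] (TG F G) X (Construction.T̂ F G coreg G◇ adj G-epi δ-epi Y)
                       (λ u → Category._≈_ (Comma F G)
                                (Category._∘_ (Comma F G) (Construction.ϑ F G coreg G◇ adj Y)
                                                          (Functor.F₁ (𝒩 F G) {X} {Construction.T̂ F G coreg G◇ adj G-epi δ-epi Y} u))
                                h))
                  × Coreflective (Comma F G) (Cosimple F G)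
mainTheorem13 F G coreg G-faithful G-epi G◇ adj δ-epi =
  ϑ-couniversal , coreflective
  where open CosimpleCoreflection F G coreg G-faithful G-epi G◇ adj δ-epi
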